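{- Let $n$ be a positive integer. There exists a bijective map $\varphi : \Pi_n \to \Sigma_{n^2}$ such that for all $P, Q \in \Pi_n$, the matrices $P$ and $Q$ are disjoint (in the sense of $\Pi_n$ matrices) if and only if $\varphi(P)$ and $\varphi(Q)$ are disjoint (in the sense of binary matrices).
   Context: Let $\mathbb{Z}_n = \{1,2,\ldots,n\}$. $\Pi_n$ denotes the set of all $(2n)\times n$ matrices with entries in $\mathbb{Z}_n$ in which every row is a permutation of all elements of $\mathbb{Z}_n$. Two matrices $C=[c_{ij}]_{2n\times n}$ and $D=[d_{ij}]_{2n\times n}$ in $\Pi_n$ (rows indexed $1,\ldots,2n$, columns $1,\ldots,n$) are called disjoint if there are no $s,t \in \{1,\ldots,n\}$ such that the ordered pair $\langle c_{st}, c_{n+t,\,s}\rangle$ equals the ordered pair $\langle d_{st}, d_{n+t,\,s}\rangle$. A binary matrix is a matrix with entries in $\{0,1\}$. A square binary matrix is a permutation matrix if it has exactly one 1 in every row and every column. $\Sigma_{n^2}$ denotes the set of all $n^2\times n^2$ binary permutation matrices $A$ which, when partitioned into $n^2$ blocks $A_{st}$ ($0\le s,t\le n-1$) of size $n\times n$ (block $A_{st}$ consisting of rows $sn,\ldots,sn+n-1$ and columns $tn,\ldots,tn+n-1$, indices starting at 0), have exactly one entry equal to 1 in each block $A_{st}$ (such matrices are called S-permutation matrices). Two binary matrices $A=[a_{ij}]$ and $B=[b_{ij}]$ of the same size are disjoint if there are no indices $i,j$ with $a_{ij}=b_{ij}=1$. -}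

module Defs where

open import Data.Nat using (ℕ; _+_; _*_)
open import Data.Fin using (Fin; _↑ˡ_; _↑ʳ_; combine)
open import Data.Bool using (Bool; true)
open import Data.Product using (Σ; _×_; ∃; ∃-syntax; _,_)
open import Relation.Binary.PropositionalEquality using (_≡_)
open import Relation.Nullary using (¬_)
open import Function.Bundles using (_⇔_)

-- Z_n = {1,..,n} is represented by Fin n = {0,..,n-1} (relabelling k ↦ k-1).
-- Rows 1..2n are Fin (n + n); row n+t (t ∈ 1..n) is  n ↑ʳ t , row s is  s ↑ˡ n.

∃! : ∀ {m} → (Fin m → Set) → Set
∃! {m} P = Σ (Fin m) λ x → P x × (∀ y → P y → y ≡ x)

IsPermutationRow : ∀ {n} → (Fin n → Fin n) → Set
IsPermutationRow {n} r = ∀ (k : Fin n) → ∃! (λ j → r j ≡ k)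

Π : ℕ → Set
Π n = Σ (Fin (n + n) → Fin n → Fin n) λ c → ∀ i → IsPermutationRow (c i)

entryΠ : ∀ {n} → Π n → Fin (n + n) → Fin n → Fin n
entryΠ (c , _) = c

DisjointΠ : ∀ {n} → Π n → Π n → Set
DisjointΠ {n} C D = ¬ (∃[ s ] ∃[ t ]
  (entryΠ C (s ↑ˡ n) t ≡ entryΠ D (s ↑ˡ n) t ×
   entryΠ C (n ↑ʳ t) s ≡ entryΠ D (n ↑ʳ t) s))

BinMatrix : ℕ → ℕ → Set
BinMatrix m k = Fin m → Fin k → Bool

IsPermutationMatrix : ∀ {m} → BinMatrix m m → Set
IsPermutationMatrix A = (∀ i → ∃! (λ j → A i j ≡ true)) × (∀ j → ∃! (λ i → A i j ≡ true))

-- block (s,t) of size n×n: rows s*n + a, columns t*n + b  (combine s a = s*n + a)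
IsSPermutation : ∀ n → BinMatrix (n * n) (n * n) → Set
IsSPermutation n A = IsPermutationMatrix A ×
  (∀ (s t : Fin n) → Σ (Fin n × Fin n) λ { (a , b) →
     A (combine s a) (combine t b) ≡ true ×
     (∀ a' b' → A (combine s a') (combine t b') ≡ true → (a' , b') ≡ (a , b)) })

SPerm : ℕ → Set
SPerm n = Σ (BinMatrix (n * n) (n * n)) (IsSPermutation n)

entryΣ : ∀ {n} → SPerm n → BinMatrix (n * n) (n * n)
entryΣ (A , _) = A

DisjointBin : ∀ {m k} → BinMatrix m k → BinMatrix m k → Set
DisjointBin A B = ¬ (∃[ i ] ∃[ j ] (A i j ≡ true × B i j ≡ true))

_≈Π_ : ∀ {n} → Π n → Π n → Set
C ≈Π D = ∀ i j → entryΠ C i j ≡ entryΠ D i j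

_≈Σ_ : ∀ {n} → SPerm n → SPerm n → Set
_≈Σ_ {n} A B = ∀ i j → entryΣ {n} A i j ≡ entryΣ {n} B i j

IsBijective : ∀ {n} → (Π n → SPerm n) → Set
IsBijective {n} φ =
  (∀ P Q → φ P ≈Σ φ Q → P ≈Π Q) ×
  (∀ (A : SPerm n) → ∃[ P ] (φ P ≈Σ A))

{-# OPTIONS --safe #-}
-- An S-permutation matrix is determined by the position (a , b) of the 1 in each block (s , t),
-- and a matrix C ∈ Π_n supplies exactly such data through a = c_{st} and b = c_{n+t,s}.
-- Row (s , a) of the binary matrix has a 1 in block (s , t) iff c_{st} = a, so it has exactly
-- one 1 iff row s of C is a permutation; column (t , b) likewise corresponds to row n + t.
-- Two such binary matrices share a 1 iff some block has the same position in both, which is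
-- the disjointness of Π_n.
module Submission where

open import Defs
open import Data.Bool using (Bool; true; false)
open import Data.Fin using (Fin; combine; remQuot; splitAt; join; _↑ˡ_; _↑ʳ_)
open import Data.Fin.Properties
  using (_≟_; remQuot-combine; combine-surjective; combine-injective; join-splitAt; splitAt-↑ˡ; splitAt-↑ʳ)
open import Data.Nat using (ℕ; NonZero; _*_)
open import Data.Product using (Σ; _×_; _,_; proj₁; proj₂; swap; ∃-syntax)
open import Data.Product.Function.NonDependent.Propositional using (_×-⇔_)
open import Data.Product.Properties using (≡-dec; ×-≡,≡→≡; ×-≡,≡←≡)
open import Data.Sum using (_⊎_; inj₁; inj₂)
open import Function.Base using (_∘_)
open import Function.Bundles using (_⇔_; mk⇔; Equivalence)
open import Function.Construct.Composition using (_⇔-∘_)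
open import Function.Construct.Symmetry using (⇔-sym)
open import Relation.Binary.PropositionalEquality using (_≡_; refl; sym; trans; cong; cong₂; subst)
open import Relation.Nullary using (Dec; yes; no; does; ¬_; contradiction)

open Equivalence using (to; from)

does-true⇔ : ∀ {a} {A : Set a} (d : Dec A) → does d ≡ true ⇔ A
does-true⇔ (yes a) = mk⇔ (λ _ → a) (λ _ → refl)
does-true⇔ (no ¬a) = mk⇔ (λ ()) (λ a → contradiction a ¬a)

≡true⇔⇒≡ : ∀ {x y : Bool} → (x ≡ true ⇔ y ≡ true) → x ≡ y
≡true⇔⇒≡ {true}          x⇔y = sym (to x⇔y refl)
≡true⇔⇒≡ {false} {true}  x⇔y = from x⇔y refl
≡true⇔⇒≡ {false} {false} _   = refl

BlockPositions : ℕ → ℕ → Set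
BlockPositions m k = Fin m → Fin m → Fin k × Fin k

record HasBlockPositions {m k} (A : BinMatrix (m * k) (m * k)) (p : BlockPositions m k) : Set where
  constructor hasBlockPositions
  field
    true⇔position : ∀ s a t b → A (combine s a) (combine t b) ≡ true ⇔ p s t ≡ (a , b)

open HasBlockPositions

module _ {m k : ℕ} where

  blockEntry : BlockPositions m k → Fin m × Fin k → Fin m × Fin k → Bool
  blockEntry p (s , a) (t , b) = does (≡-dec _≟_ _≟_ (p s t) (a , b))

  blockMatrix : BlockPositions m k → BinMatrix (m * k) (m * k)
  blockMatrix p i j = blockEntry p (remQuot k i) (remQuot k j)

  blockMatrix-combine : ∀ p s a t b →
    blockMatrix p (combine s a) (combine t b) ≡ blockEntry p (s , a) (t , b)
  blockMatrix-combine p s a t b = cong₂ (blockEntry p) (remQuot-combine s a) (remQuot-combine t b)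

  blockMatrix-hasBlockPositions : ∀ p → HasBlockPositions (blockMatrix p) p
  blockMatrix-hasBlockPositions p = hasBlockPositions λ s a t b →
    subst (λ x → x ≡ true ⇔ p s t ≡ (a , b)) (sym (blockMatrix-combine p s a t b))
      (does-true⇔ (≡-dec _≟_ _≟_ (p s t) (a , b)))

module _ {m k : ℕ} {A : BinMatrix (m * k) (m * k)} {p : BlockPositions m k} (hA : HasBlockPositions A p) where

  atBlockPosition : ∀ s t → A (combine s (proj₁ (p s t))) (combine t (proj₂ (p s t))) ≡ true
  atBlockPosition s t = from (hA .true⇔position s _ t _) refl

  hasBlockPositions-transpose : HasBlockPositions (λ i j → A j i) (λ t s → swap (p s t))
  hasBlockPositions-transpose = hasBlockPositions λ t b s a →
    mk⇔ (cong swap) (cong swap) ⇔-∘ hA .true⇔position s a t b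

  module _ {B : BinMatrix (m * k) (m * k)} {q : BlockPositions m k} (hB : HasBlockPositions B q) where

    hasBlockPositions-≈⇔ : (∀ i j → A i j ≡ B i j) ⇔ (∀ s t → p s t ≡ q s t)
    hasBlockPositions-≈⇔ = mk⇔ positionsAgree entriesAgree
      where
      positionsAgree : (∀ i j → A i j ≡ B i j) → ∀ s t → p s t ≡ q s t
      positionsAgree A≈B s t =
        sym (to (hB .true⇔position s _ t _) (trans (sym (A≈B _ _)) (atBlockPosition s t)))

      entriesAgree : (∀ s t → p s t ≡ q s t) → ∀ i j → A i j ≡ B i j
      entriesAgree p≗q i j with combine-surjective {m} {k} i | combine-surjective {m} {k} j
      ... | s , a , refl | t , b , refl =
        ≡true⇔⇒≡ (⇔-sym (hB .true⇔position s a t b) ⇔-∘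
                  (mk⇔ (trans (sym (p≗q s t))) (trans (p≗q s t)) ⇔-∘ hA .true⇔position s a t b))

    hasBlockPositions-disjoint⇔ : DisjointBin A B ⇔ (¬ (∃[ s ] ∃[ t ] p s t ≡ q s t))
    hasBlockPositions-disjoint⇔ = mk⇔ noCommonPosition noCommonEntry
      where
      noCommonPosition : DisjointBin A B → ¬ (∃[ s ] ∃[ t ] p s t ≡ q s t)
      noCommonPosition disjoint (s , t , p≡q) =
        disjoint (_ , _ , atBlockPosition s t , from (hB .true⇔position s _ t _) (sym p≡q))

      noCommonEntry : (¬ (∃[ s ] ∃[ t ] p s t ≡ q s t)) → DisjointBin A B
      noCommonEntry distinct (i , j , Aij , Bij)
        with combine-surjective {m} {k} i | combine-surjective {m} {k} j
      ... | s , a , refl | t , b , refl =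
        distinct (s , t , trans (to (hA .true⇔position s a t b) Aij)
                                (sym (to (hB .true⇔position s a t b) Bij)))

PositionsPermute : ∀ {n} → BlockPositions n n → Set
PositionsPermute p =
  (∀ s → IsPermutationRow (λ t → proj₁ (p s t))) × (∀ t → IsPermutationRow (λ s → proj₂ (p s t)))

module _ {n : ℕ} {A : BinMatrix (n * n) (n * n)} {p : BlockPositions n n} (hA : HasBlockPositions A p) where

  rowsUnique⇔rowsPermute : (∀ i → ∃! λ j → A i j ≡ true) ⇔ (∀ s → IsPermutationRow (λ t → proj₁ (p s t)))
  rowsUnique⇔rowsPermute = mk⇔ rowsPermute rowsUnique
    where
    rowsPermute : (∀ i → ∃! λ j → A i j ≡ true) → ∀ s → IsPermutationRow (λ t → proj₁ (p s t))
    rowsPermute unique s a with unique (combine s a)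
    ... | j , Aij , onlyJ with combine-surjective {n} {n} j
    ... | t , b , refl = t , cong proj₁ (to (hA .true⇔position s a t b) Aij) , onlyT
      where
      onlyT : ∀ t' → proj₁ (p s t') ≡ a → t' ≡ t
      onlyT t' refl = proj₁ (combine-injective t' _ t b (onlyJ _ (atBlockPosition hA s t')))

    rowsUnique : (∀ s → IsPermutationRow (λ t → proj₁ (p s t))) → ∀ i → ∃! λ j → A i j ≡ true
    rowsUnique permute i with combine-surjective {n} {n} i
    ... | s , a , refl with permute s a
    ... | t , refl , onlyT = combine t (proj₂ (p s t)) , atBlockPosition hA s t , onlyJ
      where
      onlyJ : ∀ j → A (combine s (proj₁ (p s t))) j ≡ true → j ≡ combine t (proj₂ (p s t))
      onlyJ j Aij with combine-surjective {n} {n} j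
      ... | t' , b , refl with to (hA .true⇔position s _ t' b) Aij
      ... | pst'≡ab with onlyT t' (cong proj₁ pst'≡ab)
      ... | refl = cong (combine t) (sym (cong proj₂ pst'≡ab))

isPermutationMatrix⇔ : ∀ {n A} {p : BlockPositions n n} →
  HasBlockPositions A p → IsPermutationMatrix A ⇔ PositionsPermute p
isPermutationMatrix⇔ hA =
  rowsUnique⇔rowsPermute hA ×-⇔ rowsUnique⇔rowsPermute (hasBlockPositions-transpose hA)

module _ {n : ℕ} where

  hasBlockPositions⇒isSPermutation : ∀ {A} {p : BlockPositions n n} →
    HasBlockPositions A p → PositionsPermute p → IsSPermutation n A
  hasBlockPositions⇒isSPermutation {p = p} hA permute =
    from (isPermutationMatrix⇔ hA) permute ,
    λ s t → p s t , atBlockPosition hA s t , λ a b Aab → sym (to (hA .true⇔position s a t b) Aab)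

  blockPositions : SPerm n → BlockPositions n n
  blockPositions (_ , _ , blocks) s t = proj₁ (blocks s t)

  blockPositions-correct : (S : SPerm n) → HasBlockPositions (entryΣ {n} S) (blockPositions S)
  blockPositions-correct (A , _ , blocks) = hasBlockPositions λ s a t b → mk⇔
    (λ Aab → sym (proj₂ (proj₂ (blocks s t)) a b Aab))
    (λ p≡ab → subst (λ (a′ , b′) → A (combine s a′) (combine t b′) ≡ true) p≡ab
                    (proj₁ (proj₂ (blocks s t))))

  blockPositions-permute : (S : SPerm n) → PositionsPermute (blockPositions S)
  blockPositions-permute S@(_ , isPermutation , _) =
    to (isPermutationMatrix⇔ (blockPositions-correct S)) isPermutation

  positions : Π n → BlockPositions n n
  positions C s t = entryΠ C (s ↑ˡ n) t , entryΠ C (n ↑ʳ t) s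

  positions-permute : (C : Π n) → PositionsPermute (positions C)
  positions-permute (_ , rowsPermute) = (λ s → rowsPermute (s ↑ˡ n)) , (λ t → rowsPermute (n ↑ʳ t))

  positions-injective : ∀ C D → (∀ s t → positions C s t ≡ positions D s t) → C ≈Π D
  positions-injective C D C≗D i j =
    subst (λ i → entryΠ C i j ≡ entryΠ D i j) (join-splitAt n n i) (rowsAgree (splitAt n i))
    where
    rowsAgree : ∀ r → entryΠ C (join n n r) j ≡ entryΠ D (join n n r) j
    rowsAgree (inj₁ s) = proj₁ (×-≡,≡←≡ (C≗D s j))
    rowsAgree (inj₂ t) = proj₂ (×-≡,≡←≡ (C≗D j t))

  module _ (p : BlockPositions n n) where

    positionsRow : Fin n ⊎ Fin n → Fin n → Fin n
    positionsRow (inj₁ s) t = proj₁ (p s t)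
    positionsRow (inj₂ t) s = proj₂ (p s t)

    fromPositions : PositionsPermute p → Π n
    fromPositions (rowsPermute , colsPermute) =
      (λ i → positionsRow (splitAt n i)) , λ i → rowPermutes (splitAt n i)
      where
      rowPermutes : ∀ r → IsPermutationRow (positionsRow r)
      rowPermutes (inj₁ s) = rowsPermute s
      rowPermutes (inj₂ t) = colsPermute t

    positions-fromPositions : ∀ permute s t → positions (fromPositions permute) s t ≡ p s t
    positions-fromPositions _ s t =
      cong₂ _,_ (cong (λ r → positionsRow r t) (splitAt-↑ˡ n s n))
                (cong (λ r → positionsRow r s) (splitAt-↑ʳ n n t))

  toSPerm : Π n → SPerm n
  toSPerm C = blockMatrix (positions C) ,
    hasBlockPositions⇒isSPermutation (blockMatrix-hasBlockPositions (positions C)) (positions-permute C)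

  toSPerm-hasPositions : ∀ C → HasBlockPositions (entryΣ {n} (toSPerm C)) (positions C)
  toSPerm-hasPositions C = blockMatrix-hasBlockPositions (positions C)

  disjointΠ⇔ : ∀ C D → DisjointΠ C D ⇔ (¬ (∃[ s ] ∃[ t ] positions C s t ≡ positions D s t))
  disjointΠ⇔ C D = mk⇔
    (λ disjoint (s , t , C≡D) → disjoint (s , t , ×-≡,≡←≡ C≡D))
    (λ distinct (s , t , C≡D) → distinct (s , t , ×-≡,≡→≡ C≡D))

theorem1 : (n : ℕ) → .{{_ : NonZero n}} →
    Σ (Π n → SPerm n) λ φ → IsBijective φ ×
    (∀ P Q → DisjointΠ P Q ⇔ DisjointBin (entryΣ {n} (φ P)) (entryΣ {n} (φ Q)))
-- The construction also works for n = 0.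
theorem1 n = toSPerm , (injective , surjective) , disjoint
  where
  injective : ∀ C D → toSPerm C ≈Σ toSPerm D → C ≈Π D
  injective C D =
    positions-injective C D ∘ to (hasBlockPositions-≈⇔ (toSPerm-hasPositions C) (toSPerm-hasPositions D))

  surjective : ∀ S → ∃[ C ] (toSPerm C ≈Σ S)
  surjective S = C , from (hasBlockPositions-≈⇔ (toSPerm-hasPositions C) (blockPositions-correct S))
                          (positions-fromPositions (blockPositions S) (blockPositions-permute S))
    where
    C : Π n
    C = fromPositions (blockPositions S) (blockPositions-permute S)

  disjoint : ∀ C D → DisjointΠ C D ⇔ DisjointBin (entryΣ {n} (toSPerm C)) (entryΣ {n} (toSPerm D))
  disjoint C D =
    ⇔-sym (hasBlockPositions-disjoint⇔ (toSPerm-hasPositions C) (toSPerm-hasPositions D)) ⇔-∘ disjointΠ⇔ C D
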